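{- Let $d\ge 2$ and $D\ge 1$. For every connected $d$-regular digraph $G$ of diameter $D$ there exist a routing scheme consisting of a walk from $u$ to $v$ for every ordered pair $(u,v)$ of vertices (an all-to-all routing scheme) and a routing schedule for it with no waiting and time \[\tau\le \mu(d,D)=\frac{D d^{D+1}-(D+1)d^{D}+1}{(1-d)^2}.\]
   Context: A digraph (multiple edges allowed) is $d$-regular if every vertex has in-degree and out-degree $d$; the distance from $u$ to $v$ is the length of a shortest directed path from $u$ to $v$, and the diameter is the maximum distance. A routing scheme is a collection of walks. A routing schedule of time $\tau$ assigns to every edge-occurrence of every walk a time in $\{1,\dots,\tau\}$ such that along each walk times are strictly increasing and no edge of $G$ is assigned the same time twice. It has no waiting if along each walk the assigned times are consecutive integers. -}

module Defs where

open import Data.Nat using (ℕ; zero; suc; _+_; _*_; _∸_; _^_; _≤_; _<_)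
open import Data.Fin using (Fin; toℕ) renaming (zero to fzero; suc to fsuc; _≟_ to _≟ᶠ_)
open import Data.List using (List; length; filter; allFin)
open import Data.Product using (Σ; _×_; _,_; proj₁; proj₂)
open import Relation.Binary.PropositionalEquality using (_≡_)

-- A finite digraph with multiple edges (and loops) allowed:
-- vertices Fin n, edges Fin m, each edge has a source and a target.
record Digraph (n m : ℕ) : Set where
  field
    src : Fin m → Fin n
    tgt : Fin m → Fin n
open Digraph public

module _ {n m : ℕ} (G : Digraph n m) where

  outdeg : Fin n → ℕ
  outdeg v = length (filter (λ e → src G e ≟ᶠ v) (allFin m))

  indeg : Fin n → ℕ
  indeg v = length (filter (λ e → tgt G e ≟ᶠ v) (allFin m))

  IsRegular : ℕ → Set
  IsRegular d = (v : Fin n) → (indeg v ≡ d) × (outdeg v ≡ d)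

  data Walk : Fin n → Fin n → Set where
    []  : ∀ {u} → Walk u u
    cons : ∀ {u v} (e : Fin m) → src G e ≡ u → Walk (tgt G e) v → Walk u v

  len : ∀ {u v} → Walk u v → ℕ
  len [] = 0
  len (cons e _ w) = suc (len w)

  edgeAt : ∀ {u v} (w : Walk u v) → Fin (len w) → Fin m
  edgeAt (cons e _ w) fzero = e
  edgeAt (cons e _ w) (fsuc i) = edgeAt w i

  -- connected (in the strong sense; implied anyway by having finite diameter)
  Connected : Set
  Connected = (u v : Fin n) → Walk u v

  HasDiameter : ℕ → Set
  HasDiameter D =
    ((u v : Fin n) → Σ (Walk u v) (λ w → len w ≤ D))
    × Σ (Fin n) (λ u → Σ (Fin n) (λ v → (w : Walk u v) → D ≤ len w))

  AllToAllScheme : Set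
  AllToAllScheme = (u v : Fin n) → Walk u v

  -- edge-occurrences of a scheme: (pair (u,v), position in the walk)
  Occ : AllToAllScheme → Set
  Occ R = Σ (Fin n × Fin n) (λ p → Fin (len (R (proj₁ p) (proj₂ p))))

  occEdge : (R : AllToAllScheme) → Occ R → Fin m
  occEdge R ((u , v) , i) = edgeAt (R u v) i

  record Schedule (R : AllToAllScheme) (τ : ℕ) : Set where
    field
      time       : Occ R → ℕ
      inRange    : (o : Occ R) → (1 ≤ time o) × (time o ≤ τ)
      increasing : (u v : Fin n) (i j : Fin (len (R u v))) →
                   toℕ i < toℕ j → time ((u , v) , i) < time ((u , v) , j)
      noClash    : (o o′ : Occ R) → occEdge R o ≡ occEdge R o′ →
                   time o ≡ time o′ → o ≡ o′

  NoWaiting : {R : AllToAllScheme} {τ : ℕ} → Schedule R τ → Set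
  NoWaiting {R} S = (u v : Fin n) (i j : Fin (len (R u v))) →
    toℕ j ≡ suc (toℕ i) →
    Schedule.time S ((u , v) , j) ≡ suc (Schedule.time S ((u , v) , i))

-- τ ≤ μ(d,D) = (D d^(D+1) − (D+1) d^D + 1)/(1−d)², cleared of the
-- (exact, positive for d ≥ 2) denominator (d−1)²:
BoundedByMu : ℕ → ℕ → ℕ → Set
BoundedByMu d D τ = τ * (d ∸ 1) ^ 2 + (D + 1) * d ^ D ≤ D * d ^ (D + 1) + 1

-- Colour the edges with d colours so that edges sharing a tail or sharing a head get distinct
-- colours (König's theorem for the bipartite double cover of G, proved by Kempe-chain
-- recolouring).  A walk is then determined by its colour sequence together with any one of its
-- edge-occurrences.  Route every pair along a walk of length at most D.  A walk e₀ … e_L with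
-- colours c₀ … c_L is sent in the block of slots reserved for length L + 1, its i-th edge at
-- offset i + (L + 1) r, where r < d^L is the base-d numeral with digits c_j − c₀ mod d (j ≥ 1).
-- Two occurrences of an edge at the same time therefore have equal lengths, positions and
-- codes r; the colour of the shared edge then recovers c₀, hence the whole colour sequence,
-- hence the endpoints.  The blocks have sizes (L + 1) d^L for L < D, which sum to μ(d,D).
module Submission where

open import Defs
open import Data.Nat as ℕ using (ℕ; zero; suc; _+_; _*_; _∸_; _^_; _≤_; _<_; z≤n; s≤s; s≤s⁻¹; pred; NonZero)
open import Data.Nat.Properties hiding (_≟_)
open import Data.Nat.Solver using (module +-*-Solver)
open import Data.Nat.DivMod using (_%_; [m+kn]%n≡m%n; m<n⇒m%n≡m)
open import Data.Fin using (Fin; toℕ; fromℕ<; _≟_) renaming (zero to fzero; suc to fsuc)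
open import Data.Fin.Properties using (toℕ-injective; toℕ<n; toℕ-fromℕ<; injective⇒≤; any?)
open import Data.Fin.Permutation.Components using (transpose; transpose-inverse)
open import Data.Vec.Functional using (updateAt)
open import Data.Vec.Functional.Properties using (updateAt-updates; updateAt-minimal)
open import Data.List using (length; filter; allFin; lookup)
open import Data.List.Relation.Unary.Any using (index)
open import Data.List.Relation.Unary.Any.Properties using (lookup-index)
open import Data.List.Membership.Propositional using (_∈_)
open import Data.List.Membership.Propositional.Properties using (∈-filter⁺; ∈-allFin)
open import Data.Product using (Σ; ∃; _×_; _,_; proj₁; proj₂; uncurry)
open import Data.Sum using (_⊎_; inj₁; inj₂; [_,_])
open import Data.Empty using (⊥; ⊥-elim)
open import Data.Unit using (⊤; tt)
open import Function using (const)
open import Function.Definitions using (Injective)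
open import Relation.Nullary using (¬_; Dec; yes; no)
open import Relation.Nullary.Decidable using (map′; _×-dec_; _⊎-dec_; ¬?; decidable-stable)
open import Relation.Binary.PropositionalEquality hiding ([_])
open import Relation.Binary.Definitions using (tri<; tri≈; tri>)

-- Proper edge colourings of bipartite multigraphs

deg : ∀ {m p} → (Fin m → Fin p) → Fin p → ℕ
deg {m} h x = length (filter (λ e → h e ≟ x) (allFin m))

injective⇒≤deg : ∀ {m p a} (h : Fin m → Fin p) {x : Fin p} (f : Fin a → Fin m) →
  Injective _≡_ _≡_ f → (∀ i → h (f i) ≡ x) → a ≤ deg h x
injective⇒≤deg {m} h {x} f f-injective f-at = injective⇒≤ position-injective
  where
  fibre = filter (λ e → h e ≟ x) (allFin m)

  member : ∀ i → f i ∈ fibre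
  member i = ∈-filter⁺ (λ e → h e ≟ x) (∈-allFin (f i)) (f-at i)

  position-injective : Injective _≡_ _≡_ (λ i → index (member i))
  position-injective {i} {j} eq = f-injective (begin
    f i                             ≡⟨ lookup-index (member i) ⟩
    lookup fibre (index (member i)) ≡⟨ cong (lookup fibre) eq ⟩
    lookup fibre (index (member j)) ≡⟨ lookup-index (member j) ⟨
    f j                             ∎)
    where open ≡-Reasoning

transpose-matchˡ : ∀ {n} (i j : Fin n) → transpose i j i ≡ j
transpose-matchˡ i j with i ≟ i
... | yes _ = refl
... | no i≢i = ⊥-elim (i≢i refl)

transpose-matchʳ : ∀ {n} (i j : Fin n) → transpose i j j ≡ i
transpose-matchʳ i j with j ≟ i
... | yes j≡i = j≡i
... | no _ with j ≟ j
...   | yes _ = refl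
...   | no j≢j = ⊥-elim (j≢j refl)

transpose-injective : ∀ {n} (i j : Fin n) → Injective _≡_ _≡_ (transpose i j)
transpose-injective i j eq =
  trans (sym (transpose-inverse j i)) (trans (cong (transpose j i) eq) (transpose-inverse j i))

module _ {m p d : ℕ} (h : Fin m → Fin p) (k : ℕ) (col : Fin m → Fin d) where

  -- Partial colourings: only the edges e with toℕ e < k count as coloured.
  Incident : Fin p → Fin d → Fin m → Set
  Incident x γ e = toℕ e < k × h e ≡ x × col e ≡ γ

  incident? : ∀ x γ e → Dec (Incident x γ e)
  incident? x γ e = toℕ e ℕ.<? k ×-dec h e ≟ x ×-dec col e ≟ γ

  Missing : Fin p → Fin d → Set
  Missing x γ = ¬ ∃ (Incident x γ)

  Proper : Set
  Proper = ∀ {e e'} → toℕ e < k → toℕ e' < k → h e ≡ h e' → col e ≡ col e' → e ≡ e'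

missingColour : ∀ {m p d} (h : Fin m → Fin p) (k : ℕ) (col : Fin m → Fin d) {e* : Fin m} →
  toℕ e* ≡ k → deg h (h e*) ≤ d → ∃ (Missing h k col (h e*))
missingColour {m} {d = d} h k col {e*} e*≡k deg≤d
  with any? (λ γ → ¬? (any? (incident? h k col (h e*) γ)))
... | yes found = found
... | no none = ⊥-elim (1+n≰n (≤-trans (injective⇒≤deg h edge edge-injective edge-at) deg≤d))
  where
  -- Every colour is used at h e*, and e* itself is there too: d + 1 edges.
  used : ∀ γ → ∃ (Incident h k col (h e*) γ)
  used γ = decidable-stable (any? (incident? h k col (h e*) γ)) (λ missing → none (γ , missing))

  edge : Fin (suc d) → Fin m
  edge fzero = e*
  edge (fsuc γ) = proj₁ (used γ)

  edge-at : ∀ i → h (edge i) ≡ h e*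
  edge-at fzero = refl
  edge-at (fsuc γ) = proj₁ (proj₂ (proj₂ (used γ)))

  e*-unused : ∀ γ → e* ≢ proj₁ (used γ)
  e*-unused γ eq = <-irrefl e*≡k (subst (λ e → toℕ e < k) (sym eq) (proj₁ (proj₂ (used γ))))

  edge-injective : Injective _≡_ _≡_ edge
  edge-injective {fzero} {fzero} _ = refl
  edge-injective {fzero} {fsuc γ} eq = ⊥-elim (e*-unused γ eq)
  edge-injective {fsuc γ} {fzero} eq = ⊥-elim (e*-unused γ (sym eq))
  edge-injective {fsuc γ} {fsuc γ'} eq = cong fsuc (begin
    γ                      ≡⟨ proj₂ (proj₂ (proj₂ (used γ))) ⟨
    col (proj₁ (used γ))   ≡⟨ cong col eq ⟩
    col (proj₁ (used γ'))  ≡⟨ proj₂ (proj₂ (proj₂ (used γ'))) ⟩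
    γ'                     ∎)
    where open ≡-Reasoning

<1+k-≢⇒<k : ∀ {m k} {e e* : Fin m} → toℕ e* ≡ k → toℕ e < suc k → e ≢ e* → toℕ e < k
<1+k-≢⇒<k e*≡k e<1+k e≢e* with m≤n⇒m<n∨m≡n (s≤s⁻¹ e<1+k)
... | inj₁ e<k = e<k
... | inj₂ e≡k = ⊥-elim (e≢e* (toℕ-injective (trans e≡k (sym e*≡k))))

assign-proper : ∀ {m p d} (h : Fin m → Fin p) {k : ℕ} {col : Fin m → Fin d} {e* : Fin m} {α : Fin d} →
  toℕ e* ≡ k → Missing h k col (h e*) α → Proper h k col →
  Proper h (suc k) (updateAt col e* (const α))
assign-proper h {k} {col} {e*} {α} e*≡k α-missing proper {e} {e'} e<1+k e'<1+k same-end same-colour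
  with e ≟ e* | e' ≟ e*
... | yes refl | yes refl = refl
... | no e≢e*  | no e'≢e* = proper (<1+k-≢⇒<k e*≡k e<1+k e≢e*) (<1+k-≢⇒<k e*≡k e'<1+k e'≢e*) same-end (begin
  col e                                 ≡⟨ updateAt-minimal e e* col e≢e* ⟨
  updateAt col e* (const α) e           ≡⟨ same-colour ⟩
  updateAt col e* (const α) e'          ≡⟨ updateAt-minimal e' e* col e'≢e* ⟩
  col e'                                ∎)
  where open ≡-Reasoning
... | yes refl | no e'≢e* = ⊥-elim (α-missing (e' , <1+k-≢⇒<k e*≡k e'<1+k e'≢e* , sym same-end ,
  trans (sym (updateAt-minimal e' e* col e'≢e*)) (trans (sym same-colour) (updateAt-updates e* col))))
... | no e≢e*  | yes refl = ⊥-elim (α-missing (e , <1+k-≢⇒<k e*≡k e<1+k e≢e* , same-end ,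
  trans (sym (updateAt-minimal e e* col e≢e*)) (trans same-colour (updateAt-updates e* col))))

transpose-≡ˡ⇒ : ∀ {n} {i j x : Fin n} → transpose i j x ≡ i → x ≡ j
transpose-≡ˡ⇒ {i = i} {j} {x} eq = begin
  x                              ≡⟨ transpose-inverse j i ⟨
  transpose j i (transpose i j x) ≡⟨ cong (transpose j i) eq ⟩
  transpose j i i                ≡⟨ transpose-matchʳ j i ⟩
  j                              ∎
  where open ≡-Reasoning

-- Swap α and β along the alternating path that starts with the α-edge e₁ at v.  Properness
-- survives because the path is a whole component of the α/β-subgraph; α becomes missing at v,
-- and stays missing at u since each β-edge of the path follows an α-edge at the same source.
module KempeChain {m p q d : ℕ} (src : Fin m → Fin p) (tgt : Fin m → Fin q) (k : ℕ)
  (col : Fin m → Fin d) (proper-src : Proper src k col) (proper-tgt : Proper tgt k col)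
  {u : Fin p} {v : Fin q} {α β : Fin d}
  (α-missing-at-u : Missing src k col u α) (β-missing-at-v : Missing tgt k col v β)
  {e₁ : Fin m} (e₁-incident : Incident tgt k col v α e₁) where

  α≢β : α ≢ β
  α≢β α≡β = β-missing-at-v (e₁ , subst (λ γ → Incident tgt k col v γ e₁) α≡β e₁-incident)

  data Step (e e' : Fin m) : Set where
    viaSrc : col e ≡ α → Incident src k col (src e) β e' → Step e e'
    viaTgt : col e ≡ β → Incident tgt k col (tgt e) α e' → Step e e'

  infixl 5 _▷_
  data Chain : ℕ → Fin m → Set where
    start : Chain 0 e₁
    _▷_   : ∀ {j e e'} → Chain j e → Step e e' → Chain (suc j) e'

  OnChain : Fin m → Set
  OnChain e = ∃ λ j → Chain j e

  chain-coloured : ∀ {j e} → Chain j e → toℕ e < k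
  chain-coloured start = proj₁ e₁-incident
  chain-coloured (_ ▷ viaSrc _ (e<k , _)) = e<k
  chain-coloured (_ ▷ viaTgt _ (e<k , _)) = e<k

  chain-colour : ∀ {j e} → Chain j e → col e ≡ α ⊎ col e ≡ β
  chain-colour start = inj₁ (proj₂ (proj₂ e₁-incident))
  chain-colour (_ ▷ viaSrc _ (_ , _ , e-β)) = inj₂ e-β
  chain-colour (_ ▷ viaTgt _ (_ , _ , e-α)) = inj₁ e-α

  step-injective : ∀ {f f' e} → toℕ f < k → toℕ f' < k → Step f e → Step f' e → f ≡ f'
  step-injective f<k f'<k (viaSrc f-α (_ , s , _)) (viaSrc f'-α (_ , s' , _)) =
    proper-src f<k f'<k (trans (sym s) s') (trans f-α (sym f'-α))
  step-injective f<k f'<k (viaTgt f-β (_ , t , _)) (viaTgt f'-β (_ , t' , _)) =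
    proper-tgt f<k f'<k (trans (sym t) t') (trans f-β (sym f'-β))
  step-injective _ _ (viaSrc _ (_ , _ , e-β)) (viaTgt _ (_ , _ , e-α)) = ⊥-elim (α≢β (trans (sym e-α) e-β))
  step-injective _ _ (viaTgt _ (_ , _ , e-α)) (viaSrc _ (_ , _ , e-β)) = ⊥-elim (α≢β (trans (sym e-α) e-β))

  e₁-has-no-predecessor : ∀ {j f} → Chain j f → ¬ Step f e₁
  e₁-has-no-predecessor _ (viaSrc _ (_ , _ , e₁-β)) = α≢β (trans (sym (proj₂ (proj₂ e₁-incident))) e₁-β)
  e₁-has-no-predecessor {f = f} c (viaTgt f-β (_ , t , _)) =
    β-missing-at-v (f , chain-coloured c , trans (sym t) (proj₁ (proj₂ e₁-incident)) , f-β)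

  chain-injective : ∀ {i j e} → Chain i e → Chain j e → i ≡ j
  chain-injective start start = refl
  chain-injective start (c ▷ s) = ⊥-elim (e₁-has-no-predecessor c s)
  chain-injective (c ▷ s) start = ⊥-elim (e₁-has-no-predecessor c s)
  chain-injective (c ▷ s) (c' ▷ s') with step-injective (chain-coloured c) (chain-coloured c') s s'
  ... | refl = cong suc (chain-injective c c')

  chain-prefix : ∀ {i j e} → i ≤ j → Chain j e → ∃ (Chain i)
  chain-prefix i≤j c with m≤n⇒m<n∨m≡n i≤j
  chain-prefix _ c       | inj₂ refl  = _ , c
  chain-prefix _ start   | inj₁ ()
  chain-prefix _ (c ▷ _) | inj₁ i<1+j = chain-prefix (s≤s⁻¹ i<1+j) c

  chain-length<m : ∀ {j e} → Chain j e → j < m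
  chain-length<m {j} c = injective⇒≤ visit-injective
    where
    visit : Fin (suc j) → Fin m
    visit i = proj₁ (chain-prefix (s≤s⁻¹ (toℕ<n i)) c)

    visit-injective : Injective _≡_ _≡_ visit
    visit-injective {i} {i'} eq = toℕ-injective (chain-injective
      (proj₂ (chain-prefix (s≤s⁻¹ (toℕ<n i)) c))
      (subst (Chain (toℕ i')) (sym eq) (proj₂ (chain-prefix (s≤s⁻¹ (toℕ<n i')) c))))

  step? : ∀ e e' → Dec (Step e e')
  step? e e' = map′ [ uncurry viaSrc , uncurry viaTgt ]
    (λ { (viaSrc e-α i) → inj₁ (e-α , i) ; (viaTgt e-β i) → inj₂ (e-β , i) })
    ((col e ≟ α ×-dec incident? src k col (src e) β e') ⊎-dec (col e ≟ β ×-dec incident? tgt k col (tgt e) α e'))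

  chain? : ∀ j e → Dec (Chain j e)
  chain? zero e = map′ (λ { refl → start }) (λ { start → refl }) (e ≟ e₁)
  chain? (suc j) e' = map′ (λ (e , c , s) → c ▷ s) (λ { (c ▷ s) → _ , c , s })
    (any? λ e → chain? j e ×-dec step? e e')

  onChain? : ∀ e → Dec (OnChain e)
  onChain? e = map′ (λ (j , c) → toℕ j , c)
    (λ (j , c) → fromℕ< (chain-length<m c) , subst (λ i → Chain i e) (sym (toℕ-fromℕ< _)) c)
    (any? λ (j : Fin m) → chain? (toℕ j) e)

  predecessor-at-src : ∀ {j e} → Chain j e → col e ≡ β → ∃ λ f → OnChain f × Incident src k col (src e) α f
  predecessor-at-src start e₁-β = ⊥-elim (α≢β (trans (sym (proj₂ (proj₂ e₁-incident))) e₁-β))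
  predecessor-at-src (c ▷ viaSrc f-α (_ , s , _)) _ = _ , (_ , c) , chain-coloured c , sym s , f-α
  predecessor-at-src (_ ▷ viaTgt _ (_ , _ , e-α)) e-β = ⊥-elim (α≢β (trans (sym e-α) e-β))

  predecessor-at-tgt : ∀ {j e} → Chain j e → col e ≡ α →
    e ≡ e₁ ⊎ ∃ λ f → OnChain f × Incident tgt k col (tgt e) β f
  predecessor-at-tgt start _ = inj₁ refl
  predecessor-at-tgt (_ ▷ viaSrc _ (_ , _ , e-β)) e-α = ⊥-elim (α≢β (trans (sym e-α) e-β))
  predecessor-at-tgt (c ▷ viaTgt f-β (_ , t , _)) _ = inj₂ (_ , (_ , c) , chain-coloured c , sym t , f-β)

  recoloured : Fin m → Fin d
  recoloured e with onChain? e
  ... | yes _ = transpose α β (col e)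
  ... | no _  = col e

  recoloured-on : ∀ {e} → OnChain e → recoloured e ≡ transpose α β (col e)
  recoloured-on {e} on with onChain? e
  ... | yes _   = refl
  ... | no off  = ⊥-elim (off on)

  recoloured-off : ∀ {e} → ¬ OnChain e → recoloured e ≡ col e
  recoloured-off {e} off with onChain? e
  ... | yes on = ⊥-elim (off on)
  ... | no _   = refl

  recoloured-across : ∀ {e e'} → OnChain e → ¬ OnChain e' → recoloured e ≡ recoloured e' →
    col e' ≡ transpose α β (col e)
  recoloured-across on off same-colour =
    trans (sym (recoloured-off off)) (trans (sym same-colour) (recoloured-on on))

  colours-across : ∀ {e e'} → OnChain e → ¬ OnChain e' → recoloured e ≡ recoloured e' →
    (col e ≡ α × col e' ≡ β) ⊎ (col e ≡ β × col e' ≡ α)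
  colours-across on@(_ , c) off same-colour with chain-colour c
  ... | inj₁ e-α = inj₁ (e-α , trans (recoloured-across on off same-colour)
                                     (trans (cong (transpose α β) e-α) (transpose-matchˡ α β)))
  ... | inj₂ e-β = inj₂ (e-β , trans (recoloured-across on off same-colour)
                                     (trans (cong (transpose α β) e-β) (transpose-matchʳ α β)))

  boundary-src : ∀ {e e'} → OnChain e → ¬ OnChain e' → toℕ e' < k → src e ≡ src e' → recoloured e ≢ recoloured e'
  boundary-src (j , c) off e'<k same-src same-colour with colours-across (j , c) off same-colour
  ... | inj₁ (e-α , e'-β) = off (suc j , c ▷ viaSrc e-α (e'<k , sym same-src , e'-β))
  ... | inj₂ (e-β , e'-α) with predecessor-at-src c e-β
  ...   | f , on-f , f<k , f-src , f-α =
    off (subst OnChain (proper-src f<k e'<k (trans f-src same-src) (trans f-α (sym e'-α))) on-f)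

  boundary-tgt : ∀ {e e'} → OnChain e → ¬ OnChain e' → toℕ e' < k → tgt e ≡ tgt e' → recoloured e ≢ recoloured e'
  boundary-tgt {e' = e'} (j , c) off e'<k same-tgt same-colour with colours-across (j , c) off same-colour
  ... | inj₂ (e-β , e'-α) = off (suc j , c ▷ viaTgt e-β (e'<k , sym same-tgt , e'-α))
  ... | inj₁ (e-α , e'-β) with predecessor-at-tgt c e-α
  ...   | inj₁ refl = β-missing-at-v (e' , e'<k , trans (sym same-tgt) (proj₁ (proj₂ e₁-incident)) , e'-β)
  ...   | inj₂ (f , on-f , f<k , f-tgt , f-β) =
    off (subst OnChain (proper-tgt f<k e'<k (trans f-tgt same-tgt) (trans f-β (sym e'-β))) on-f)

  recoloured-proper : ∀ {r} (h : Fin m → Fin r) → Proper h k col →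
    (∀ {e e'} → OnChain e → ¬ OnChain e' → toℕ e' < k → h e ≡ h e' → recoloured e ≢ recoloured e') →
    Proper h k recoloured
  recoloured-proper h proper boundary {e} {e'} e<k e'<k same-end same-colour =
    cases (onChain? e) (onChain? e')
    where
    cases : Dec (OnChain e) → Dec (OnChain e') → e ≡ e'
    cases (yes on) (yes on') = proper e<k e'<k same-end (transpose-injective α β
      (trans (sym (recoloured-on on)) (trans same-colour (recoloured-on on'))))
    cases (no off) (no off') = proper e<k e'<k same-end
      (trans (sym (recoloured-off off)) (trans same-colour (recoloured-off off')))
    cases (yes on) (no off') = ⊥-elim (boundary on off' e'<k same-end same-colour)
    cases (no off) (yes on') = ⊥-elim (boundary on' off e<k (sym same-end) (sym same-colour))

  recoloured-proper-src : Proper src k recoloured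
  recoloured-proper-src = recoloured-proper src proper-src boundary-src

  recoloured-proper-tgt : Proper tgt k recoloured
  recoloured-proper-tgt = recoloured-proper tgt proper-tgt boundary-tgt

  α-missing-at-u′ : Missing src k recoloured u α
  α-missing-at-u′ (e , e<k , at-u , e-α′) with onChain? e
  ... | no _ = α-missing-at-u (e , e<k , at-u , e-α′)
  ... | yes (_ , c) with predecessor-at-src c (transpose-≡ˡ⇒ e-α′)
  ...   | f , _ , f<k , f-src , f-α = α-missing-at-u (f , f<k , trans f-src at-u , f-α)

  α-missing-at-v′ : Missing tgt k recoloured v α
  α-missing-at-v′ (e , e<k , at-v , e-α′) with onChain? e
  ... | yes _ = β-missing-at-v (e , e<k , at-v , transpose-≡ˡ⇒ e-α′)
  ... | no off = off (subst OnChain e₁≡e (0 , start))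
    where
    e₁≡e : e₁ ≡ e
    e₁≡e = proper-tgt (proj₁ e₁-incident) e<k (trans (proj₁ (proj₂ e₁-incident)) (sym at-v))
      (trans (proj₂ (proj₂ e₁-incident)) (sym e-α′))

commonMissingColour : ∀ {m p q d} (src : Fin m → Fin p) (tgt : Fin m → Fin q) {k : ℕ}
  {col : Fin m → Fin d} {u : Fin p} {v : Fin q} {α β : Fin d} →
  Proper src k col → Proper tgt k col → Missing src k col u α → Missing tgt k col v β →
  ∃ λ col′ → Proper src k col′ × Proper tgt k col′ × Missing src k col′ u α × Missing tgt k col′ v α
commonMissingColour src tgt {k} {col} {u} {v} {α} proper-src proper-tgt α-at-u β-at-v
  with any? (incident? tgt k col v α)
... | no α-at-v = col , proper-src , proper-tgt , α-at-u , α-at-v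
... | yes (_ , e₁-incident) =
  recoloured , recoloured-proper-src , recoloured-proper-tgt , α-missing-at-u′ , α-missing-at-v′
  where open KempeChain src tgt k col proper-src proper-tgt α-at-u β-at-v e₁-incident

extendColouring : ∀ {m p q d} (src : Fin m → Fin p) (tgt : Fin m → Fin q) {k : ℕ}
  {col : Fin m → Fin d} {e* : Fin m} → toℕ e* ≡ k → deg src (src e*) ≤ d → deg tgt (tgt e*) ≤ d →
  Proper src k col → Proper tgt k col → ∃ λ col′ → Proper src (suc k) col′ × Proper tgt (suc k) col′
extendColouring src tgt {k} {col} {e*} e*≡k src-deg tgt-deg proper-src proper-tgt
  with missingColour src k col e*≡k src-deg | missingColour tgt k col e*≡k tgt-deg
... | α , α-at-src | β , β-at-tgt
  with commonMissingColour src tgt proper-src proper-tgt α-at-src β-at-tgt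
...   | col′ , proper-src′ , proper-tgt′ , α-at-src′ , α-at-tgt′ =
  updateAt col′ e* (const α) ,
  assign-proper src e*≡k α-at-src′ proper-src′ , assign-proper tgt e*≡k α-at-tgt′ proper-tgt′

properEdgeColouring : ∀ {m p q d} (src : Fin m → Fin p) (tgt : Fin m → Fin q) →
  (∀ x → deg src x ≤ d) → (∀ y → deg tgt y ≤ d) →
  ∃ λ (col : Fin m → Fin d) → (∀ {e e'} → src e ≡ src e' → col e ≡ col e' → e ≡ e')
                            × (∀ {e e'} → tgt e ≡ tgt e' → col e ≡ col e' → e ≡ e')
properEdgeColouring {m} {d = d} src tgt src-deg tgt-deg =
  let col , proper-src , proper-tgt = colourFirst m ≤-refl
  in col , (λ {e} {e'} → proper-src (toℕ<n e) (toℕ<n e')) , (λ {e} {e'} → proper-tgt (toℕ<n e) (toℕ<n e'))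
  where
  -- Any edge e gives 1 ≤ deg src (src e) ≤ d, so colours exist.
  someColour : Fin m → Fin d
  someColour e = fromℕ< (≤-trans
    (injective⇒≤deg src (λ (_ : Fin 1) → e) (λ { {fzero} {fzero} _ → refl }) (λ _ → refl))
    (src-deg (src e)))

  colourFirst : ∀ k → k ≤ m → ∃ λ col → Proper src k col × Proper tgt k col
  colourFirst zero _ = someColour , (λ ()) , (λ ())
  colourFirst (suc k) k<m =
    let col , proper-src , proper-tgt = colourFirst k (<⇒≤ k<m)
    in extendColouring src tgt (toℕ-fromℕ< k<m) (src-deg _) (tgt-deg _) proper-src proper-tgt

-- Arithmetic of the schedule

-- Walks of length j + 1 are sent in the slots (μ d j, μ d (j + 1)].
μ : ℕ → ℕ → ℕ
μ d zero    = 0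
μ d (suc j) = μ d j + d ^ j * suc j

μ-mono : ∀ d {i j} → i ≤ j → μ d i ≤ μ d j
μ-mono d i≤j with m≤n⇒m<n∨m≡n i≤j
μ-mono d _ | inj₂ refl = ≤-refl
μ-mono d {j = suc j} _ | inj₁ i<1+j = ≤-trans (μ-mono d (s≤s⁻¹ i<1+j)) (m≤m+n (μ d j) _)

μ-closedForm : ∀ c D → μ (suc c) D * (c * c) + (D + 1) * suc c ^ D ≡ D * (suc c * suc c ^ D) + 1
μ-closedForm c zero = refl
-- Both sides are increased by (D + 1) d^D so that the induction step needs no subtraction.
μ-closedForm c (suc D) = +-cancelʳ-≡ ((D + 1) * x) _ _ (begin
    (μ d D + x * suc D) * (c * c) + (suc D + 1) * (d * x) + (D + 1) * x
      ≡⟨ solve 6 (λ s D x c d c² →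
           (s :+ x :* (con 1 :+ D)) :* c² :+ ((con 1 :+ D) :+ con 1) :* (d :* x) :+ (D :+ con 1) :* x
           := (s :* c² :+ (D :+ con 1) :* x) :+ (con 1 :+ D) :* x :* c² :+ ((con 1 :+ D) :+ con 1) :* (d :* x))
         refl (μ d D) D x c d (c * c) ⟩
    (μ d D * (c * c) + (D + 1) * x) + suc D * x * (c * c) + (suc D + 1) * (d * x)
      ≡⟨ cong (λ z → z + suc D * x * (c * c) + (suc D + 1) * (d * x)) (μ-closedForm c D) ⟩
    D * (d * x) + 1 + suc D * x * (c * c) + (suc D + 1) * (d * x)
      ≡⟨ solve 3 (λ D x c →
           D :* ((con 1 :+ c) :* x) :+ con 1 :+ (con 1 :+ D) :* x :* (c :* c) :+ ((con 1 :+ D) :+ con 1) :* ((con 1 :+ c) :* x)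
           := (con 1 :+ D) :* ((con 1 :+ c) :* ((con 1 :+ c) :* x)) :+ con 1 :+ (D :+ con 1) :* x)
         refl D x c ⟩
    suc D * (d * (d * x)) + 1 + (D + 1) * x ∎)
  where
  open ≡-Reasoning
  open +-*-Solver
  d = suc c
  x = suc c ^ D

μ-boundedByMu : ∀ c D → BoundedByMu (suc c) D (μ (suc c) D)
μ-boundedByMu c D = ≤-reflexive (begin
  μ d D * (d ∸ 1) ^ 2 + (D + 1) * d ^ D   ≡⟨ cong (λ z → μ d D * z + (D + 1) * d ^ D) (cong (c *_) (*-identityʳ c)) ⟩
  μ d D * (c * c) + (D + 1) * d ^ D       ≡⟨ μ-closedForm c D ⟩
  D * (d * d ^ D) + 1                     ≡⟨ cong (λ z → D * z + 1) d·dᴰ≡dᴰ⁺¹ ⟩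
  D * d ^ (D + 1) + 1                     ∎)
  where
  open ≡-Reasoning
  d = suc c
  d·dᴰ≡dᴰ⁺¹ : d * d ^ D ≡ d ^ (D + 1)
  d·dᴰ≡dᴰ⁺¹ = trans (*-comm d (d ^ D)) (sym (trans (^-distribˡ-+-* d D 1) (cong (d ^ D *_) (*-identityʳ d))))

wraps-around : ∀ {d x y} → x < d → x ≢ y + d
wraps-around {d} {x} {y} x<d x≡y+d = <-irrefl refl (<-≤-trans x<d (≤-trans (m≤n+m d y) (≤-reflexive (sym x≡y+d))))

_⊖_ : ∀ {d} → Fin d → Fin d → ℕ
_⊖_ {d} a c with toℕ c ℕ.≤? toℕ a
... | yes _ = toℕ a ∸ toℕ c
... | no _  = toℕ a + d ∸ toℕ c

⊖-spec : ∀ {d} (a c : Fin d) → a ⊖ c + toℕ c ≡ toℕ a ⊎ a ⊖ c + toℕ c ≡ toℕ a + d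
⊖-spec {d} a c with toℕ c ℕ.≤? toℕ a
... | yes c≤a = inj₁ (m∸n+n≡m c≤a)
... | no _    = inj₂ (m∸n+n≡m (≤-trans (<⇒≤ (toℕ<n c)) (m≤n+m d (toℕ a))))

⊖<d : ∀ {d} (a c : Fin d) → a ⊖ c < d
⊖<d {d} a c with toℕ c ℕ.≤? toℕ a
... | yes _   = ≤-<-trans (m∸n≤m (toℕ a) (toℕ c)) (toℕ<n a)
... | no c≰a  = subst (toℕ a + d ∸ toℕ c <_) (m+n∸m≡n (toℕ c) d)
  (∸-monoˡ-< (+-monoˡ-< d (≰⇒> c≰a)) (≤-trans (<⇒≤ (toℕ<n c)) (m≤n+m d (toℕ a))))

⊖-injectiveˡ : ∀ {d} {a a' : Fin d} (c : Fin d) → a ⊖ c ≡ a' ⊖ c → a ≡ a'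
⊖-injectiveˡ {d} {a} {a'} c eq with ⊖-spec a c | ⊖-spec a' c
... | inj₁ p | inj₁ q = toℕ-injective (trans (sym p) (trans (cong (_+ toℕ c) eq) q))
... | inj₂ p | inj₂ q = toℕ-injective (+-cancelʳ-≡ d _ _ (trans (sym p) (trans (cong (_+ toℕ c) eq) q)))
... | inj₁ p | inj₂ q = ⊥-elim (wraps-around (toℕ<n a) (trans (sym p) (trans (cong (_+ toℕ c) eq) q)))
... | inj₂ p | inj₁ q = ⊥-elim (wraps-around (toℕ<n a') (trans (sym q) (trans (cong (_+ toℕ c) (sym eq)) p)))

⊖-injectiveʳ : ∀ {d} (a : Fin d) {c c' : Fin d} → a ⊖ c ≡ a ⊖ c' → c ≡ c'
⊖-injectiveʳ {d} a {c} {c'} eq with ⊖-spec a c | ⊖-spec a c'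
... | inj₁ p | inj₁ q = toℕ-injective (+-cancelˡ-≡ (a ⊖ c) _ _ (trans p (trans (sym q) (cong (_+ toℕ c') (sym eq)))))
... | inj₂ p | inj₂ q = toℕ-injective (+-cancelˡ-≡ (a ⊖ c) _ _ (trans p (trans (sym q) (cong (_+ toℕ c') (sym eq)))))
... | inj₁ p | inj₂ q = ⊥-elim (wraps-around (toℕ<n c') (+-cancelˡ-≡ (a ⊖ c) _ _ (begin
  a ⊖ c + toℕ c'        ≡⟨ cong (_+ toℕ c') eq ⟩
  a ⊖ c' + toℕ c'       ≡⟨ q ⟩
  toℕ a + d             ≡⟨ cong (_+ d) p ⟨
  a ⊖ c + toℕ c + d     ≡⟨ +-assoc (a ⊖ c) (toℕ c) d ⟩
  a ⊖ c + (toℕ c + d)   ∎)))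
  where open ≡-Reasoning
... | inj₂ p | inj₁ q = ⊥-elim (wraps-around (toℕ<n c) (+-cancelˡ-≡ (a ⊖ c') _ _ (begin
  a ⊖ c' + toℕ c        ≡⟨ cong (_+ toℕ c) eq ⟨
  a ⊖ c + toℕ c         ≡⟨ p ⟩
  toℕ a + d             ≡⟨ cong (_+ d) q ⟨
  a ⊖ c' + toℕ c' + d   ≡⟨ +-assoc (a ⊖ c') (toℕ c') d ⟩
  a ⊖ c' + (toℕ c' + d) ∎)))
  where open ≡-Reasoning

digits-< : ∀ {b x y c} → x < b → y < c → x + y * b < c * b
digits-< {b} {x} {y} x<b y<c = ≤-trans (+-monoˡ-< (y * b) x<b) (*-monoˡ-≤ b y<c)

digits-unique : ∀ {b} .{{_ : NonZero b}} {x y x' y'} → x < b → x' < b →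
  x + y * b ≡ x' + y' * b → x ≡ x' × y ≡ y'
digits-unique {b} {x} {y} {x'} {y'} x<b x'<b eq =
  x≡x' , *-cancelʳ-≡ y y' b (+-cancelˡ-≡ x _ _ (trans eq (cong (_+ y' * b) (sym x≡x'))))
  where
  open ≡-Reasoning
  x≡x' : x ≡ x'
  x≡x' = begin
    x                ≡⟨ m<n⇒m%n≡m x<b ⟨
    x % b            ≡⟨ [m+kn]%n≡m%n x y b ⟨
    (x + y * b) % b  ≡⟨ cong (_% b) eq ⟩
    (x' + y' * b) % b ≡⟨ [m+kn]%n≡m%n x' y' b ⟩
    x' % b           ≡⟨ m<n⇒m%n≡m x'<b ⟩
    x'               ∎

-- The schedule

module Scheduling {n m d : ℕ} .{{_ : NonZero d}} (G : Digraph n m) (col : Fin m → Fin d)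
  (proper-out : ∀ {e e'} → src G e ≡ src G e' → col e ≡ col e' → e ≡ e')
  (proper-in  : ∀ {e e'} → tgt G e ≡ tgt G e' → col e ≡ col e' → e ≡ e') where

  SameColours : ∀ {a b a' b'} → Walk G a b → Walk G a' b' → Set
  SameColours []           []             = ⊤
  SameColours (cons e _ w) (cons e' _ w') = col e ≡ col e' × SameColours w w'
  SameColours _            _              = ⊥

  sameColours⇒≡end : ∀ {a b a' b'} (w : Walk G a b) (w' : Walk G a' b') → SameColours w w' → a ≡ a' → b ≡ b'
  sameColours⇒≡end [] [] _ a≡a' = a≡a'
  sameColours⇒≡end (cons e p w) (cons e' p' w') (same-colour , same) a≡a'
    with proper-out (trans p (trans a≡a' (sym p'))) same-colour
  ... | refl = sameColours⇒≡end w w' same refl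

  sameColours⇒≡ends : ∀ {a b a' b'} (w : Walk G a b) (w' : Walk G a' b') → SameColours w w' →
    (i : Fin (len G w)) (i' : Fin (len G w')) → toℕ i ≡ toℕ i' → edgeAt G w i ≡ edgeAt G w' i' →
    a ≡ a' × b ≡ b'
  sameColours⇒≡ends (cons e p w) (cons e p' w') (_ , same) fzero fzero _ refl =
    trans (sym p) p' , sameColours⇒≡end w w' same refl
  sameColours⇒≡ends (cons e p w) (cons e' p' w') (same-colour , same) (fsuc i) (fsuc i') i≡i' same-edge
    with sameColours⇒≡ends w w' same i i' (suc-injective i≡i') same-edge
  ... | tgt≡ , b≡b' with proper-in tgt≡ same-colour
  ...   | refl = trans (sym p) p' , b≡b'

  code : ∀ {a b} → Fin d → Walk G a b → ℕ
  code c₀ []           = 0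
  code c₀ (cons e _ w) = col e ⊖ c₀ + code c₀ w * d

  code< : ∀ {a b} (c₀ : Fin d) (w : Walk G a b) → code c₀ w < d ^ len G w
  code< c₀ []           = s≤s z≤n
  code< c₀ (cons e p w) = subst (code c₀ (cons e p w) <_) (*-comm (d ^ len G w) d)
    (digits-< (⊖<d (col e) c₀) (code< c₀ w))

  code⇒sameColours : ∀ {a b a' b'} (c₀ : Fin d) (w : Walk G a b) (w' : Walk G a' b') →
    len G w ≡ len G w' → code c₀ w ≡ code c₀ w' → SameColours w w'
  code⇒sameColours c₀ [] [] _ _ = tt
  code⇒sameColours c₀ (cons e _ w) (cons e' _ w') len≡ code≡ =
    let digit≡ , rest≡ = digits-unique (⊖<d (col e) c₀) (⊖<d (col e') c₀) code≡
    in ⊖-injectiveˡ c₀ digit≡ , code⇒sameColours c₀ w w' (suc-injective len≡) rest≡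

  code⇒≡base : ∀ {a b a' b'} (c₀ c₁ : Fin d) (w : Walk G a b) (w' : Walk G a' b') → code c₀ w ≡ code c₁ w' →
    (i : Fin (len G w)) (i' : Fin (len G w')) → toℕ i ≡ toℕ i' → edgeAt G w i ≡ edgeAt G w' i' → c₀ ≡ c₁
  code⇒≡base c₀ c₁ (cons e _ w) (cons e _ w') code≡ fzero fzero _ refl =
    ⊖-injectiveʳ (col e) (proj₁ (digits-unique {y = code c₀ w} {y' = code c₁ w'} (⊖<d (col e) c₀) (⊖<d (col e) c₁) code≡))
  code⇒≡base c₀ c₁ (cons e _ w) (cons e' _ w') code≡ (fsuc i) (fsuc i') i≡i' same-edge =
    code⇒≡base c₀ c₁ w w' (proj₂ (digits-unique (⊖<d (col e) c₀) (⊖<d (col e') c₁) code≡))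
      i i' (suc-injective i≡i') same-edge

  code⇒≡firstColour : ∀ {a b a' b'} {e e' : Fin m} {p : src G e ≡ a} {p' : src G e' ≡ a'}
    (w : Walk G (tgt G e) b) (w' : Walk G (tgt G e') b') → code (col e) w ≡ code (col e') w' →
    (i : Fin (suc (len G w))) (i' : Fin (suc (len G w'))) → toℕ i ≡ toℕ i' →
    edgeAt G (cons e p w) i ≡ edgeAt G (cons e' p' w') i' → col e ≡ col e'
  code⇒≡firstColour w w' _ fzero fzero _ same-edge = cong col same-edge
  code⇒≡firstColour {e = e} {e'} w w' code≡ (fsuc i) (fsuc i') i≡i' same-edge =
    code⇒≡base (col e) (col e') w w' code≡ i i' (suc-injective i≡i') same-edge

  sendTime : ∀ {a b} (w : Walk G a b) → Fin (len G w) → ℕ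
  sendTime (cons e _ w) i = suc (μ d (len G w) + (toℕ i + code (col e) w * suc (len G w)))

  sendTime-block : ∀ {a b} (w : Walk G a b) (i : Fin (len G w)) →
    μ d (pred (len G w)) < sendTime w i × sendTime w i ≤ μ d (len G w)
  sendTime-block (cons e _ w) i =
    s≤s (m≤m+n _ _) , +-monoʳ-< (μ d (len G w)) (digits-< (toℕ<n i) (code< (col e) w))

  sendTime-<-len : ∀ {a b a' b'} (w : Walk G a b) (w' : Walk G a' b') (i : Fin (len G w)) (i' : Fin (len G w')) →
    len G w < len G w' → sendTime w i < sendTime w' i'
  sendTime-<-len w w' i i' shorter = ≤-<-trans (proj₂ (sendTime-block w i))
    (≤-<-trans (μ-mono d (<⇒≤pred shorter)) (proj₁ (sendTime-block w' i')))

  sendTime-≡⇒≡len : ∀ {a b a' b'} (w : Walk G a b) (w' : Walk G a' b') (i : Fin (len G w)) (i' : Fin (len G w')) →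
    sendTime w i ≡ sendTime w' i' → len G w ≡ len G w'
  sendTime-≡⇒≡len w w' i i' same-time with <-cmp (len G w) (len G w')
  ... | tri< shorter _ _ = ⊥-elim (<-irrefl same-time (sendTime-<-len w w' i i' shorter))
  ... | tri≈ _ len≡ _    = len≡
  ... | tri> _ _ longer  = ⊥-elim (<-irrefl (sym same-time) (sendTime-<-len w' w i' i longer))

  sendTime-collision : ∀ {a b a' b'} (w : Walk G a b) (w' : Walk G a' b') (i : Fin (len G w)) (i' : Fin (len G w')) →
    edgeAt G w i ≡ edgeAt G w' i' → sendTime w i ≡ sendTime w' i' → a ≡ a' × b ≡ b' × toℕ i ≡ toℕ i'
  sendTime-collision w@(cons e p ws) w'@(cons e' p' ws') i i' same-edge same-time =
    let a≡a' , b≡b' = sameColours⇒≡ends w w' same-colours i i' i≡i' same-edge in a≡a' , b≡b' , i≡i'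
    where
    L≡L' : len G ws ≡ len G ws'
    L≡L' = suc-injective (sendTime-≡⇒≡len w w' i i' same-time)

    slot≡ : toℕ i + code (col e) ws * suc (len G ws) ≡ toℕ i' + code (col e') ws' * suc (len G ws)
    slot≡ = +-cancelˡ-≡ (μ d (len G ws)) _ _ (trans (suc-injective same-time)
      (cong (λ L → μ d L + (toℕ i' + code (col e') ws' * suc L)) (sym L≡L')))

    i≡i'×code≡ : toℕ i ≡ toℕ i' × code (col e) ws ≡ code (col e') ws'
    i≡i'×code≡ = digits-unique (toℕ<n i) (subst (λ L → toℕ i' < suc L) (sym L≡L') (toℕ<n i')) slot≡

    i≡i' = proj₁ i≡i'×code≡

    first≡ : col e ≡ col e'
    first≡ = code⇒≡firstColour ws ws' (proj₂ i≡i'×code≡) i i' i≡i' same-edge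

    same-colours : SameColours w w'
    same-colours = first≡ , code⇒sameColours (col e) ws ws' L≡L'
      (trans (proj₂ i≡i'×code≡) (cong (λ c → code c ws') (sym first≡)))

  sendTime-range : ∀ {a b} {D : ℕ} (w : Walk G a b) (i : Fin (len G w)) → len G w ≤ D →
    1 ≤ sendTime w i × sendTime w i ≤ μ d D
  sendTime-range (cons e p w) i len≤D = s≤s z≤n , ≤-trans (proj₂ (sendTime-block (cons e p w) i)) (μ-mono d len≤D)

  sendTime-increasing : ∀ {a b} (w : Walk G a b) (i j : Fin (len G w)) → toℕ i < toℕ j → sendTime w i < sendTime w j
  sendTime-increasing (cons e p w) i j i<j = s≤s (+-monoʳ-< (μ d (len G w)) (+-monoˡ-< _ i<j))

  sendTime-consecutive : ∀ {a b} (w : Walk G a b) (i j : Fin (len G w)) → toℕ j ≡ suc (toℕ i) →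
    sendTime w j ≡ suc (sendTime w i)
  sendTime-consecutive (cons e p w) i j j≡1+i = cong suc (trans
    (cong (λ t → μ d (len G w) + (t + code (col e) w * suc (len G w))) j≡1+i)
    (+-suc (μ d (len G w)) _))

  schedule : (R : AllToAllScheme G) (D : ℕ) → (∀ u v → len G (R u v) ≤ D) →
    Σ (Schedule G R (μ d D)) (NoWaiting G)
  schedule R D short = record
    { time       = λ ((u , v) , i) → sendTime (R u v) i
    ; inRange    = λ ((u , v) , i) → sendTime-range (R u v) i (short u v)
    ; increasing = λ u v → sendTime-increasing (R u v)
    ; noClash    = λ ((u , v) , i) ((u' , v') , i') same-edge same-time →
        occurrence-≡ (sendTime-collision (R u v) (R u' v') i i' same-edge same-time)
    } , λ u v → sendTime-consecutive (R u v)
    where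
    occurrence-≡ : ∀ {u v u' v'} {i : Fin (len G (R u v))} {i' : Fin (len G (R u' v'))} →
      u ≡ u' × v ≡ v' × toℕ i ≡ toℕ i' → _≡_ {A = Occ G R} ((u , v) , i) ((u' , v') , i')
    occurrence-≡ (refl , refl , i≡i') = cong ((_ , _) ,_) (toℕ-injective i≡i')

corollary1 : (d D : ℕ) → 2 ≤ d → 1 ≤ D →
    {n m : ℕ} (G : Digraph n m) → IsRegular G d → Connected G → HasDiameter G D →
    Σ (AllToAllScheme G) (λ R → Σ ℕ (λ τ → Σ (Schedule G R τ) (λ S →
      NoWaiting G S × BoundedByMu d D τ)))
corollary1 zero _ () _ _ _ _ _
corollary1 (suc c) D _ _ G regular _ (shortWalks , _) =
  let col , proper-out , proper-in = properEdgeColouring (src G) (tgt G)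
        (λ x → ≤-reflexive (proj₂ (regular x))) (λ y → ≤-reflexive (proj₁ (regular y)))
      S , no-waiting = Scheduling.schedule G col proper-out proper-in R D (λ u v → proj₂ (shortWalks u v))
  in R , μ (suc c) D , S , no-waiting , μ-boundedByMu c D
  where
  R : AllToAllScheme G
  R u v = proj₁ (shortWalks u v)
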